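{- Let $F=\left(x^{ -1}+1+x\right)\left(y^{ -1}+1+y\right)-1\in\mathrm{GF}(2)[x,x^{ -1},y,y^{ -1}]$ (the Moore neighborhood in $\mathbb{Z}^2$), and let $a_n=|F^n|$ be the number of ON cells at generation $n$ of the odd-rule cellular automaton with neighborhood $F$ (Fredkin's Replicator) started with a single ON cell at the origin at generation $0$. Then $a_0=1$ and, for all $t>0$, $$a_{2t}=a_t,\qquad a_{4t+1}=8a_t,\qquad a_{4t+3}=2a_{2t+1}+8a_t.$$
   Context: For a Laurent polynomial $P$ with coefficients in $\mathrm{GF}(2)$, $|P|$ denotes the number of its nonzero terms. In the odd-rule CA with neighborhood $F$, a cell $u\in\mathbb{Z}^2$ is identified with the monomial $x^{u_1}y^{u_2}$, the neighborhood of cell $w$ is $x^{w_1}y^{w_2}F$, and a cell is ON at generation $n+1$ iff it lies in the neighborhoods of an odd number of cells that are ON at generation $n$; the state at generation $n$ is $F^n$. -}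

module Defs where

open import Data.Nat using (ℕ; zero; suc)
open import Data.Integer using (ℤ; +_; -[1+_]; _+_)
open import Data.Integer.Properties using () renaming (_≟_ to _≟ℤ_)
open import Data.Product using (_×_; _,_)
open import Data.Product.Properties using (≡-dec)
open import Data.List using (List; []; _∷_; foldr; map; length)
open import Relation.Nullary using (yes; no)
open import Relation.Binary.Definitions using (DecidableEquality)

-- A monomial x^i y^j of GF(2)[x,x⁻¹,y,y⁻¹] is identified with its exponent
-- vector, i.e. the cell (i , j) ∈ ℤ².
Cell : Set
Cell = ℤ × ℤ

_≟c_ : DecidableEquality Cell
_≟c_ = ≡-dec _≟ℤ_ _≟ℤ_

-- A Laurent polynomial over GF(2) is represented by its support: the list of
-- monomials with coefficient 1.  All operations below keep lists
-- duplicate-free (given duplicate-free inputs), so the length of the list is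
-- the number of nonzero terms.
LPoly : Set
LPoly = List Cell

toggle : Cell → LPoly → LPoly
toggle u [] = u ∷ []
toggle u (v ∷ vs) with u ≟c v
... | yes _ = vs
... | no  _ = v ∷ toggle u vs

_⊕_ : LPoly → LPoly → LPoly
P ⊕ Q = foldr toggle Q P

shift : Cell → LPoly → LPoly
shift (a , b) P = map (λ { (c , d) → (a + c , b + d) }) P

_⊗_ : LPoly → LPoly → LPoly
P ⊗ Q = foldr (λ u acc → shift u Q ⊕ acc) [] P

one : LPoly
one = (+ 0 , + 0) ∷ []

_^_ : LPoly → ℕ → LPoly
P ^ zero = one
P ^ suc n = P ⊗ (P ^ n)

∣_∣ : LPoly → ℕ
∣ P ∣ = length P

m1 : ℤ
m1 = -[1+ 0 ]

F : LPoly
F = (m1 , m1) ∷ (m1 , + 0) ∷ (m1 , + 1)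
  ∷ (+ 0 , m1)             ∷ (+ 0 , + 1)
  ∷ (+ 1 , m1) ∷ (+ 1 , + 0) ∷ (+ 1 , + 1) ∷ []

a : ℕ → ℕ
a n = ∣ F ^ n ∣

-- Over GF(2) squaring is additive, so P ^ 2 = P(x², y²) and hence
-- F ^ (m s) = (F ^ s)(x^m, y^m) for every power of two m; in particular
-- a_2t = a_t.  For the other generations write F ^ j as a sum of terms
-- x^u T(x^m, y^m) whose offsets u are pairwise incongruent modulo m.  Then
-- F ^ (j + m s) = F ^ j · (F ^ s)(x^m, y^m) is a sum of translated dilations
-- of the products T · F ^ s with pairwise disjoint supports, so its size is
-- the sum of the sizes |T · F ^ s|.  The eight monomials of F are incongruent
-- modulo 4, which gives a_4t+1 = 8 a_t; for a_4t+3 one splits t by parity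
-- and both sides become the same combination of |T · F ^ s| for
-- T = 1+x, 1+y, 1+xy, x+y and (1+x)(1+y).
module Submission where

open import Defs
open import Data.Nat using (ℕ; _+_; _*_; _<_)
open import Data.Product using (_×_)
open import Relation.Binary.PropositionalEquality using (_≡_)

open import Algebra.Bundles using (CommutativeRing)
open import Data.Bool using (Bool; true; false; _xor_)
open import Data.Bool.Properties
  using (xor-∧-commutativeRing; xor-assoc; xor-identityʳ; xor-same; not-involutive)
open import Algebra.Properties.CommutativeSemigroup
  (CommutativeRing.+-commutativeSemigroup xor-∧-commutativeRing)
  using (x∙yz≈y∙xz; interchange)
open import Data.Integer using (+_; -_)
import Data.Integer as ℤ
import Data.Integer.Properties as ℤₚ
open import Algebra.Properties.AbelianGroup ℤₚ.+-0-abelianGroup using (∙-cancelˡ)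
open import Data.Integer.Divisibility.Signed using (divides)
  renaming (_∣_ to _∣ℤ_; _∣?_ to _∣ℤ?_)
open import Data.Integer.Tactic.RingSolver using () renaming (solve-∀ to ℤ-solve)
open import Data.List using (List; []; _∷_; _++_; map; length)
open import Data.Nat.ListAction using (sum)
open import Data.List.Properties using (length-map; length-++; map-∘; map-cong; map-id)
open import Data.List.Relation.Unary.All using (All; []; _∷_; universal)
import Data.List.Relation.Unary.All as All
import Data.List.Relation.Unary.All.Properties as Allₚ
open import Data.List.Relation.Unary.AllPairs using (AllPairs; []; _∷_; allPairs?)
import Data.List.Relation.Unary.AllPairs.Properties as AllPairs
import Data.Nat as ℕ
import Data.Nat.Properties as ℕₚ
open import Data.Nat.Tactic.RingSolver using () renaming (solve-∀ to ℕ-solve)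
open import Data.Product using (∃-syntax; _,_; proj₁; proj₂; map₂)
open import Data.Sum using (_⊎_; inj₁; inj₂)
open import Data.Unit using (⊤; tt)
open import Function using (_∘_; _on_)
open import Function.Definitions using (Injective)
open import Level using (0ℓ)
open import Relation.Binary.Bundles using (Setoid)
open import Relation.Binary.Definitions using (Decidable)
import Relation.Binary.Reasoning.Setoid as ≈-Reasoning
open import Relation.Binary.PropositionalEquality
  using (_≢_; refl; sym; trans; cong; cong₂; module ≡-Reasoning)
open import Relation.Nullary using (Dec; ¬_; does; yes; no)
open import Relation.Nullary.Decidable using (¬?; _×-dec_; dec-true; dec-false; True; toWitness)

private variable
  X Y : Set

-- Sums over GF(2)

xor-cancelˡ : ∀ x y → x xor (x xor y) ≡ y
xor-cancelˡ false y = refl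
xor-cancelˡ true  y = not-involutive y

xor≡false⇒≡ : ∀ {x y} → x xor y ≡ false → x ≡ y
xor≡false⇒≡ {false} {false} _ = refl
xor≡false⇒≡ {true}  {true}  _ = refl

xorSum : List X → (X → Bool) → Bool
xorSum []       g = false
xorSum (x ∷ xs) g = g x xor xorSum xs g

xorSum-cong : ∀ (xs : List X) {g h : X → Bool} → (∀ x → g x ≡ h x) → xorSum xs g ≡ xorSum xs h
xorSum-cong []       g≗h = refl
xorSum-cong (x ∷ xs) g≗h = cong₂ _xor_ (g≗h x) (xorSum-cong xs g≗h)

xorSum-All-false : ∀ {xs : List X} {g : X → Bool} → All (λ x → g x ≡ false) xs → xorSum xs g ≡ false
xorSum-All-false []           = refl
xorSum-All-false (gx≡f ∷ all) = cong₂ _xor_ gx≡f (xorSum-All-false all)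

xorSum-xor : ∀ (xs : List X) (g h : X → Bool) →
             xorSum xs (λ x → g x xor h x) ≡ xorSum xs g xor xorSum xs h
xorSum-xor []       g h = refl
xorSum-xor (x ∷ xs) g h = begin
  (g x xor h x) xor xorSum xs (λ x → g x xor h x) ≡⟨ cong ((g x xor h x) xor_) (xorSum-xor xs g h) ⟩
  (g x xor h x) xor (xorSum xs g xor xorSum xs h) ≡⟨ interchange (g x) (h x) _ _ ⟩
  (g x xor xorSum xs g) xor (h x xor xorSum xs h) ∎
  where open ≡-Reasoning

xorSum-++ : ∀ (xs ys : List X) (g : X → Bool) → xorSum (xs ++ ys) g ≡ xorSum xs g xor xorSum ys g
xorSum-++ []       ys g = refl
xorSum-++ (x ∷ xs) ys g = trans (cong (g x xor_) (xorSum-++ xs ys g)) (sym (xor-assoc (g x) _ _))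

xorSum-map : ∀ (f : X → Y) xs (g : Y → Bool) → xorSum (map f xs) g ≡ xorSum xs (g ∘ f)
xorSum-map f []       g = refl
xorSum-map f (x ∷ xs) g = cong (g (f x) xor_) (xorSum-map f xs g)

-- The off-diagonal terms of a symmetric double sum cancel in pairs.
xorSum-diagonal : ∀ (xs : List X) (h : X → X → Bool) → (∀ x y → h x y ≡ h y x) →
                  xorSum xs (λ x → xorSum xs (h x)) ≡ xorSum xs (λ x → h x x)
xorSum-diagonal []       h h-sym = refl
xorSum-diagonal (x ∷ xs) h h-sym = begin
  (h x x xor R) xor xorSum xs (λ y → h y x xor xorSum xs (h y))
    ≡⟨ cong ((h x x xor R) xor_) (xorSum-xor xs (λ y → h y x) _) ⟩
  (h x x xor R) xor (xorSum xs (λ y → h y x) xor D)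
    ≡⟨ cong (λ c → (h x x xor R) xor (c xor D)) (xorSum-cong xs (λ y → h-sym y x)) ⟩
  (h x x xor R) xor (R xor D)
    ≡⟨ xor-assoc (h x x) R (R xor D) ⟩
  h x x xor (R xor (R xor D))
    ≡⟨ cong (h x x xor_) (trans (xor-cancelˡ R D) (xorSum-diagonal xs h h-sym)) ⟩
  h x x xor xorSum xs (λ y → h y y) ∎
  where
  open ≡-Reasoning
  R D : Bool
  R = xorSum xs (h x)
  D = xorSum xs (λ y → xorSum xs (h y))

_+c_ : Cell → Cell → Cell
u +c w = (proj₁ u ℤ.+ proj₁ w , proj₂ u ℤ.+ proj₂ w)

scale : ℕ → Cell → Cell
scale m u = (+ m ℤ.* proj₁ u , + m ℤ.* proj₂ u)

+c-comm : ∀ u w → u +c w ≡ w +c u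
+c-comm u w = cong₂ _,_ (ℤₚ.+-comm (proj₁ u) (proj₁ w)) (ℤₚ.+-comm (proj₂ u) (proj₂ w))

+c-assoc : ∀ u v w → (u +c v) +c w ≡ u +c (v +c w)
+c-assoc u v w =
  cong₂ _,_ (ℤₚ.+-assoc (proj₁ u) (proj₁ v) (proj₁ w)) (ℤₚ.+-assoc (proj₂ u) (proj₂ v) (proj₂ w))

+c-identityˡ : ∀ u → (+ 0 , + 0) +c u ≡ u
+c-identityˡ u = cong₂ _,_ (ℤₚ.+-identityˡ (proj₁ u)) (ℤₚ.+-identityˡ (proj₂ u))

+c-cancelˡ : ∀ s → Injective _≡_ _≡_ (s +c_)
+c-cancelˡ s eq =
  cong₂ _,_ (∙-cancelˡ (proj₁ s) _ _ (cong proj₁ eq)) (∙-cancelˡ (proj₂ s) _ _ (cong proj₂ eq))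

scale-+c : ∀ m u w → scale m (u +c w) ≡ scale m u +c scale m w
scale-+c m u w = cong₂ _,_ (ℤₚ.*-distribˡ-+ (+ m) (proj₁ u) (proj₁ w))
                           (ℤₚ.*-distribˡ-+ (+ m) (proj₂ u) (proj₂ w))

scale-scale : ∀ m n u → scale m (scale n u) ≡ scale (m * n) u
scale-scale m n u = cong₂ _,_ (lemma (proj₁ u)) (lemma (proj₂ u))
  where
  lemma : ∀ i → + m ℤ.* (+ n ℤ.* i) ≡ + (m * n) ℤ.* i
  lemma i = trans (sym (ℤₚ.*-assoc (+ m) (+ n) i)) (cong (ℤ._* i) (sym (ℤₚ.pos-* m n)))

scale-1 : ∀ u → scale 1 u ≡ u
scale-1 u = cong₂ _,_ (ℤₚ.*-identityˡ (proj₁ u)) (ℤₚ.*-identityˡ (proj₂ u))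

scale-2 : ∀ u → scale 2 u ≡ u +c u
scale-2 u = cong₂ _,_ (lemma (proj₁ u)) (lemma (proj₂ u))
  where
  lemma : ∀ i → + 2 ℤ.* i ≡ i ℤ.+ i
  lemma = ℤ-solve

scale-injective : ∀ m .{{_ : ℕ.NonZero m}} → Injective _≡_ _≡_ (scale m)
scale-injective m eq = cong₂ _,_ (ℤₚ.*-cancelˡ-≡ (+ m) _ _ (cong proj₁ eq))
                                 (ℤₚ.*-cancelˡ-≡ (+ m) _ _ (cong proj₂ eq))

Incongruent : ℕ → Cell → Cell → Set
Incongruent m u w = ¬ ((+ m ∣ℤ proj₁ u ℤ.- proj₁ w) × (+ m ∣ℤ proj₂ u ℤ.- proj₂ w))

incongruent? : ∀ m → Decidable (Incongruent m)
incongruent? m u w = ¬? ((+ m ∣ℤ? _) ×-dec (+ m ∣ℤ? _))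

∣-difference : ∀ m i j k l → i ℤ.+ m ℤ.* k ≡ j ℤ.+ m ℤ.* l → m ∣ℤ i ℤ.- j
∣-difference m i j k l eq = divides (l ℤ.- k) (begin
  i ℤ.- j                                 ≡⟨ expand-difference m i j k ⟩
  (i ℤ.+ m ℤ.* k) ℤ.- (j ℤ.+ m ℤ.* k)   ≡⟨ cong (ℤ._- (j ℤ.+ m ℤ.* k)) eq ⟩
  (j ℤ.+ m ℤ.* l) ℤ.- (j ℤ.+ m ℤ.* k)   ≡⟨ collect-difference m j k l ⟩
  (l ℤ.- k) ℤ.* m                         ∎)
  where
  open ≡-Reasoning
  expand-difference : ∀ m i j k → i ℤ.- j ≡ (i ℤ.+ m ℤ.* k) ℤ.- (j ℤ.+ m ℤ.* k)
  expand-difference = ℤ-solve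
  collect-difference : ∀ m j k l → (j ℤ.+ m ℤ.* l) ℤ.- (j ℤ.+ m ℤ.* k) ≡ (l ℤ.- k) ℤ.* m
  collect-difference = ℤ-solve

Incongruent⇒≢ : ∀ {m s t} → Incongruent m s t → ∀ w w' → s +c scale m w ≢ t +c scale m w'
Incongruent⇒≢ {m} {s} {t} incong w w' eq = incong
  ( ∣-difference (+ m) (proj₁ s) (proj₁ t) (proj₁ w) (proj₁ w') (cong proj₁ eq)
  , ∣-difference (+ m) (proj₂ s) (proj₂ t) (proj₂ w) (proj₂ w') (cong proj₂ eq))

-- Opaque, so that unification never unfolds the decision procedure _≟c_.
opaque
  δ : Cell → Cell → Bool
  δ u v = does (u ≟c v)

  δ-refl : ∀ u → δ u u ≡ true
  δ-refl u = dec-true (u ≟c u) refl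

  δ-≢ : ∀ {u v} → u ≢ v → δ u v ≡ false
  δ-≢ {u} {v} = dec-false (u ≟c v)

δ-injective : ∀ {f} → Injective _≡_ _≡_ f → ∀ u v → δ (f u) (f v) ≡ δ u v
δ-injective {f} f-inj u v with u ≟c v
... | yes refl = trans (δ-refl (f u)) (sym (δ-refl u))
... | no  u≢v  = trans (δ-≢ (u≢v ∘ f-inj)) (sym (δ-≢ u≢v))

coeff : LPoly → Cell → Bool
coeff P v = xorSum P (λ u → δ u v)

infix 4 _≈_
record _≈_ (P Q : LPoly) : Set where
  constructor mk≈
  field coeff-≡ : ∀ v → coeff P v ≡ coeff Q v
open _≈_

≈-refl : ∀ {P} → P ≈ P
≈-refl = mk≈ λ _ → refl

≈-sym : ∀ {P Q} → P ≈ Q → Q ≈ P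
≈-sym P≈Q = mk≈ λ v → sym (coeff-≡ P≈Q v)

≈-trans : ∀ {P Q R} → P ≈ Q → Q ≈ R → P ≈ R
≈-trans P≈Q Q≈R = mk≈ λ v → trans (coeff-≡ P≈Q v) (coeff-≡ Q≈R v)

≈-setoid : Setoid 0ℓ 0ℓ
≈-setoid = record
  { Carrier       = LPoly
  ; _≈_           = _≈_
  ; isEquivalence = record { refl = ≈-refl ; sym = ≈-sym ; trans = ≈-trans }
  }

xorSum-toggle : ∀ u P (g : Cell → Bool) → xorSum (toggle u P) g ≡ g u xor xorSum P g
xorSum-toggle u []       g = refl
xorSum-toggle u (w ∷ ws) g with u ≟c w
... | yes refl = sym (xor-cancelˡ (g u) (xorSum ws g))
... | no  _    = trans (cong (g w xor_) (xorSum-toggle u ws g)) (x∙yz≈y∙xz (g w) (g u) _)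

xorSum-⊕ : ∀ P Q (g : Cell → Bool) → xorSum (P ⊕ Q) g ≡ xorSum P g xor xorSum Q g
xorSum-⊕ []      Q g = refl
xorSum-⊕ (u ∷ P) Q g = begin
  xorSum (toggle u (P ⊕ Q)) g          ≡⟨ xorSum-toggle u (P ⊕ Q) g ⟩
  g u xor xorSum (P ⊕ Q) g             ≡⟨ cong (g u xor_) (xorSum-⊕ P Q g) ⟩
  g u xor (xorSum P g xor xorSum Q g)  ≡⟨ xor-assoc (g u) _ _ ⟨
  (g u xor xorSum P g) xor xorSum Q g  ∎
  where open ≡-Reasoning

xorSum-⊗ : ∀ P Q (g : Cell → Bool) → xorSum (P ⊗ Q) g ≡ xorSum P (λ p → xorSum Q (λ q → g (p +c q)))
xorSum-⊗ []      Q g = refl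
xorSum-⊗ (u ∷ P) Q g = trans (xorSum-⊕ (shift u Q) (P ⊗ Q) g)
                             (cong₂ _xor_ (xorSum-map (u +c_) Q g) (xorSum-⊗ P Q g))

⊕≡[]⇒≈ : ∀ P Q → P ⊕ Q ≡ [] → P ≈ Q
⊕≡[]⇒≈ P Q P⊕Q≡[] = mk≈ λ v →
  xor≡false⇒≡ (trans (sym (xorSum-⊕ P Q _)) (cong (λ R → coeff R v) P⊕Q≡[]))

-- A list is reduced when it has no repeated monomial; its length is then
-- the number of nonzero terms of the polynomial it represents.
Reduced : LPoly → Set
Reduced []      = ⊤
Reduced (u ∷ P) = coeff P u ≡ false × Reduced P

toggle-Reduced : ∀ u P → Reduced P → Reduced (toggle u P)
toggle-Reduced u []       _              = refl , tt
toggle-Reduced u (w ∷ ws) (w∉ws , ws-red) with u ≟c w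
... | yes _   = ws-red
... | no  u≢w = trans (xorSum-toggle u ws _) (cong₂ _xor_ (δ-≢ u≢w) w∉ws)
              , toggle-Reduced u ws ws-red

⊕-Reduced : ∀ P Q → Reduced Q → Reduced (P ⊕ Q)
⊕-Reduced []      Q Q-red = Q-red
⊕-Reduced (u ∷ P) Q Q-red = toggle-Reduced u (P ⊕ Q) (⊕-Reduced P Q Q-red)

⊗-Reduced : ∀ P Q → Reduced (P ⊗ Q)
⊗-Reduced []      Q = tt
⊗-Reduced (u ∷ P) Q = ⊕-Reduced (shift u Q) (P ⊗ Q) (⊗-Reduced P Q)

^-Reduced : ∀ P n → Reduced (P ^ n)
^-Reduced P ℕ.zero    = refl , tt
^-Reduced P (ℕ.suc n) = ⊗-Reduced P (P ^ n)

Reduced-map : ∀ {f} → Injective _≡_ _≡_ f → ∀ P → Reduced P → Reduced (map f P)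
Reduced-map f-inj []      _             = tt
Reduced-map f-inj (u ∷ P) (u∉P , P-red) =
  trans (xorSum-map _ P _) (trans (xorSum-cong P λ w → δ-injective f-inj w u) u∉P)
  , Reduced-map f-inj P P-red

Reduced-++ : ∀ P Q → Reduced P → Reduced Q → All (λ u → coeff Q u ≡ false) P → Reduced (P ++ Q)
Reduced-++ []      Q _             Q-red _              = Q-red
Reduced-++ (u ∷ P) Q (u∉P , P-red) Q-red (u∉Q ∷ P∉Q) =
  trans (xorSum-++ P Q _) (cong₂ _xor_ u∉P u∉Q) , Reduced-++ P Q P-red Q-red P∉Q

Reduced-≈[] : ∀ R → Reduced R → R ≈ [] → R ≡ []
Reduced-≈[] []      _         _    = refl
Reduced-≈[] (u ∷ R) (u∉R , _) R≈[] with trans (sym (coeff-≡ R≈[] u)) (cong₂ _xor_ (δ-refl u) u∉R)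
... | ()

-- P ⊕ (Q ⊕ []) is reduced and has only zero coefficients, hence is empty.
xorSum-≈ : ∀ {P Q} → P ≈ Q → ∀ (g : Cell → Bool) → xorSum P g ≡ xorSum Q g
xorSum-≈ {P} {Q} P≈Q g = xor≡false⇒≡ (begin
  xorSum P g xor xorSum Q g               ≡⟨ cong (xorSum P g xor_) (xor-identityʳ _) ⟨
  xorSum P g xor (xorSum Q g xor false)   ≡⟨ cong (xorSum P g xor_) (xorSum-⊕ Q [] g) ⟨
  xorSum P g xor xorSum (Q ⊕ []) g        ≡⟨ xorSum-⊕ P (Q ⊕ []) g ⟨
  xorSum (P ⊕ (Q ⊕ [])) g                ≡⟨ cong (λ R → xorSum R g) (Reduced-≈[] R R-red R≈[]) ⟩
  false                                   ∎)
  where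
  open ≡-Reasoning
  R = P ⊕ (Q ⊕ [])
  R-red : Reduced R
  R-red = ⊕-Reduced P (Q ⊕ []) (⊕-Reduced Q [] tt)
  R≈[] : R ≈ []
  R≈[] = mk≈ λ v → begin
    coeff R v                                ≡⟨ xorSum-⊕ P (Q ⊕ []) _ ⟩
    coeff P v xor coeff (Q ⊕ []) v           ≡⟨ cong (coeff P v xor_) (xorSum-⊕ Q [] _) ⟩
    coeff P v xor (coeff Q v xor false)      ≡⟨ cong₂ _xor_ (coeff-≡ P≈Q v) (xor-identityʳ _) ⟩
    coeff Q v xor coeff Q v                  ≡⟨ xor-same (coeff Q v) ⟩
    false                                    ∎

length-toggle : ∀ u Q → coeff Q u ≡ true → ℕ.suc (length (toggle u Q)) ≡ length Q
length-toggle u []       ()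
length-toggle u (w ∷ ws) u∈Q with u ≟c w
... | yes refl = refl
... | no  u≢w  = cong ℕ.suc (length-toggle u ws
                   (trans (cong (_xor coeff ws u) (sym (δ-≢ (u≢w ∘ sym)))) u∈Q))

length-≈ : ∀ {P Q} → Reduced P → Reduced Q → P ≈ Q → length P ≡ length Q
length-≈ {[]}    {[]}    _ _ _ = refl
length-≈ {[]}    {w ∷ Q} _ (w∉Q , _) []≈Q with trans (coeff-≡ []≈Q w) (cong₂ _xor_ (δ-refl w) w∉Q)
... | ()
length-≈ {u ∷ P} {Q} (u∉P , P-red) Q-red uP≈Q =
  trans (cong ℕ.suc (length-≈ P-red (toggle-Reduced u Q Q-red) P≈Q-u))
        (length-toggle u Q (trans (sym (coeff-≡ uP≈Q u)) (cong₂ _xor_ (δ-refl u) u∉P)))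
  where
  P≈Q-u : P ≈ toggle u Q
  P≈Q-u = mk≈ λ v → sym (begin
    coeff (toggle u Q) v              ≡⟨ xorSum-toggle u Q _ ⟩
    δ u v xor coeff Q v               ≡⟨ cong (δ u v xor_) (coeff-≡ uP≈Q v) ⟨
    δ u v xor (δ u v xor coeff P v)   ≡⟨ xor-cancelˡ (δ u v) (coeff P v) ⟩
    coeff P v                         ∎)
    where open ≡-Reasoning

⊗-cong : ∀ {P P' Q Q'} → P ≈ P' → Q ≈ Q' → P ⊗ Q ≈ P' ⊗ Q'
⊗-cong {P} {P'} {Q} {Q'} P≈P' Q≈Q' = mk≈ λ v → begin
  coeff (P ⊗ Q) v                                      ≡⟨ xorSum-⊗ P Q _ ⟩
  xorSum P (λ p → xorSum Q (λ q → δ (p +c q) v))       ≡⟨ xorSum-≈ P≈P' _ ⟩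
  xorSum P' (λ p → xorSum Q (λ q → δ (p +c q) v))      ≡⟨ xorSum-cong P' (λ p → xorSum-≈ Q≈Q' _) ⟩
  xorSum P' (λ p → xorSum Q' (λ q → δ (p +c q) v))     ≡⟨ xorSum-⊗ P' Q' _ ⟨
  coeff (P' ⊗ Q') v                                    ∎
  where open ≡-Reasoning

⊗-assoc : ∀ P Q R → (P ⊗ Q) ⊗ R ≈ P ⊗ (Q ⊗ R)
⊗-assoc P Q R = mk≈ λ v → begin
  coeff ((P ⊗ Q) ⊗ R) v
    ≡⟨ xorSum-⊗ (P ⊗ Q) R _ ⟩
  xorSum (P ⊗ Q) (λ x → xorSum R (λ r → δ (x +c r) v))
    ≡⟨ xorSum-⊗ P Q _ ⟩
  xorSum P (λ p → xorSum Q (λ q → xorSum R (λ r → δ ((p +c q) +c r) v)))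
    ≡⟨ xorSum-cong P (λ p → xorSum-cong Q λ q → xorSum-cong R λ r →
         cong (λ c → δ c v) (+c-assoc p q r)) ⟩
  xorSum P (λ p → xorSum Q (λ q → xorSum R (λ r → δ (p +c (q +c r)) v)))
    ≡⟨ xorSum-cong P (λ p → xorSum-⊗ Q R _) ⟨
  xorSum P (λ p → xorSum (Q ⊗ R) (λ x → δ (p +c x) v))
    ≡⟨ xorSum-⊗ P (Q ⊗ R) _ ⟨
  coeff (P ⊗ (Q ⊗ R)) v
    ∎
  where open ≡-Reasoning

⊗-identityˡ : ∀ Q → one ⊗ Q ≈ Q
⊗-identityˡ Q = mk≈ λ v →
  trans (xorSum-⊗ one Q _)
        (trans (xor-identityʳ _) (xorSum-cong Q λ q → cong (λ c → δ c v) (+c-identityˡ q)))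

^-+ : ∀ P m n → P ^ (m + n) ≈ (P ^ m) ⊗ (P ^ n)
^-+ P ℕ.zero    n = ≈-sym (⊗-identityˡ (P ^ n))
^-+ P (ℕ.suc m) n = ≈-trans (⊗-cong (≈-refl {P}) (^-+ P m n)) (≈-sym (⊗-assoc P (P ^ m) (P ^ n)))

-- Dilation x ↦ x^m, y ↦ y^m

dilate : ℕ → LPoly → LPoly
dilate m = map (scale m)

dilate-cong : ∀ m {P Q} → P ≈ Q → dilate m P ≈ dilate m Q
dilate-cong m {P} {Q} P≈Q = mk≈ λ v →
  trans (xorSum-map (scale m) P _) (trans (xorSum-≈ P≈Q _) (sym (xorSum-map (scale m) Q _)))

dilate-1 : ∀ P → dilate 1 P ≡ P
dilate-1 P = trans (map-cong scale-1 P) (map-id P)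

dilate-dilate : ∀ m n P → dilate m (dilate n P) ≡ dilate (m * n) P
dilate-dilate m n P = trans (sym (map-∘ P)) (map-cong (scale-scale m n) P)

⊗-self≈dilate-2 : ∀ P → P ⊗ P ≈ dilate 2 P
⊗-self≈dilate-2 P = mk≈ λ v → begin
  coeff (P ⊗ P) v                                  ≡⟨ xorSum-⊗ P P _ ⟩
  xorSum P (λ p → xorSum P (λ q → δ (p +c q) v))   ≡⟨ xorSum-diagonal P (λ p q → δ (p +c q) v)
                                                        (λ p q → cong (λ c → δ c v) (+c-comm p q)) ⟩
  xorSum P (λ p → δ (p +c p) v)                    ≡⟨ xorSum-cong P (λ p →
                                                        cong (λ c → δ c v) (scale-2 p)) ⟨
  xorSum P (λ p → δ (scale 2 p) v)                 ≡⟨ xorSum-map (scale 2) P _ ⟨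
  coeff (dilate 2 P) v                             ∎
  where open ≡-Reasoning

^-2* : ∀ P n → P ^ (2 * n) ≈ dilate 2 (P ^ n)
^-2* P n = begin
  P ^ (2 * n)          ≡⟨ cong (P ^_) (cong (_+_ n) (ℕₚ.+-identityʳ n)) ⟩
  P ^ (n + n)          ≈⟨ ^-+ P n n ⟩
  (P ^ n) ⊗ (P ^ n)    ≈⟨ ⊗-self≈dilate-2 (P ^ n) ⟩
  dilate 2 (P ^ n)     ∎
  where open ≈-Reasoning ≈-setoid

^-2^k* : ∀ P k n → P ^ (2 ℕ.^ k * n) ≈ dilate (2 ℕ.^ k) (P ^ n)
^-2^k* P ℕ.zero n = begin
  P ^ (1 * n)        ≡⟨ cong (P ^_) (ℕₚ.*-identityˡ n) ⟩
  P ^ n              ≡⟨ dilate-1 (P ^ n) ⟨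
  dilate 1 (P ^ n)   ∎
  where open ≈-Reasoning ≈-setoid
^-2^k* P (ℕ.suc k) n = begin
  P ^ (2 ℕ.^ ℕ.suc k * n)                  ≡⟨ cong (P ^_) (ℕₚ.*-assoc 2 (2 ℕ.^ k) n) ⟩
  P ^ (2 * (2 ℕ.^ k * n))                  ≈⟨ ^-2* P (2 ℕ.^ k * n) ⟩
  dilate 2 (P ^ (2 ℕ.^ k * n))             ≈⟨ dilate-cong 2 (^-2^k* P k n) ⟩
  dilate 2 (dilate (2 ℕ.^ k) (P ^ n))      ≡⟨ dilate-dilate 2 (2 ℕ.^ k) (P ^ n) ⟩
  dilate (2 ℕ.^ ℕ.suc k) (P ^ n)           ∎
  where open ≈-Reasoning ≈-setoid

-- Decompositions modulo m

-- A piece (u , T) stands for x^u T(x^m, y^m).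
expand : ℕ → List (Cell × LPoly) → LPoly
expand m []             = []
expand m ((u , T) ∷ ps) = shift u (dilate m T) ++ expand m ps

Separated : ℕ → List (Cell × LPoly) → Set
Separated m = AllPairs (Incongruent m on proj₁)

separated? : ∀ m ps → Dec (Separated m ps)
separated? m = allPairs? (λ p q → incongruent? m (proj₁ p) (proj₁ q))

xorSum-expand : ∀ m ps (g : Cell → Bool) →
  xorSum (expand m ps) g ≡ xorSum ps (λ p → xorSum (proj₂ p) (λ t → g (proj₁ p +c scale m t)))
xorSum-expand m []             g = refl
xorSum-expand m ((u , T) ∷ ps) g =
  trans (xorSum-++ (shift u (dilate m T)) (expand m ps) g)
        (cong₂ _xor_ (trans (xorSum-map (u +c_) (dilate m T) g) (xorSum-map (scale m) T _))
                     (xorSum-expand m ps g))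

expand-⊗-dilate : ∀ m ps K → expand m ps ⊗ dilate m K ≈ expand m (map (map₂ (_⊗ K)) ps)
expand-⊗-dilate m ps K = mk≈ λ v → begin
  coeff (expand m ps ⊗ dilate m K) v
    ≡⟨ xorSum-⊗ (expand m ps) (dilate m K) _ ⟩
  xorSum (expand m ps) (λ x → xorSum (dilate m K) (λ y → δ (x +c y) v))
    ≡⟨ xorSum-expand m ps _ ⟩
  xorSum ps (λ p → xorSum (proj₂ p) λ t →
    xorSum (dilate m K) (λ y → δ ((proj₁ p +c scale m t) +c y) v))
    ≡⟨ xorSum-cong ps (λ p → xorSum-cong (proj₂ p) λ t → xorSum-map (scale m) K _) ⟩
  xorSum ps (λ p → xorSum (proj₂ p) λ t →
    xorSum K (λ k → δ ((proj₁ p +c scale m t) +c scale m k) v))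
    ≡⟨ xorSum-cong ps (λ p → xorSum-cong (proj₂ p) λ t → xorSum-cong K λ k →
         cong (λ c → δ c v) (collect (proj₁ p) t k)) ⟩
  xorSum ps (λ p → xorSum (proj₂ p) λ t →
    xorSum K (λ k → δ (proj₁ p +c scale m (t +c k)) v))
    ≡⟨ xorSum-cong ps (λ p → xorSum-⊗ (proj₂ p) K _) ⟨
  xorSum ps (λ p → xorSum (proj₂ p ⊗ K) (λ x → δ (proj₁ p +c scale m x) v))
    ≡⟨ xorSum-map (map₂ (_⊗ K)) ps _ ⟨
  xorSum (map (map₂ (_⊗ K)) ps) (λ p → xorSum (proj₂ p) (λ x → δ (proj₁ p +c scale m x) v))
    ≡⟨ xorSum-expand m (map (map₂ (_⊗ K)) ps) _ ⟨
  coeff (expand m (map (map₂ (_⊗ K)) ps)) v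
    ∎
  where
  open ≡-Reasoning
  collect : ∀ u t k → (u +c scale m t) +c scale m k ≡ u +c scale m (t +c k)
  collect u t k = trans (+c-assoc u _ _) (cong (u +c_) (sym (scale-+c m t k)))

coeff-expand-incongruent : ∀ {m} s ps w → All (Incongruent m s ∘ proj₁) ps →
                           coeff (expand m ps) (s +c scale m w) ≡ false
coeff-expand-incongruent {m} s ps w s≢ps =
  trans (xorSum-expand m ps _) (xorSum-All-false (All.map (λ {p} → misses p) s≢ps))
  where
  misses : ∀ p → Incongruent m s (proj₁ p) →
           xorSum (proj₂ p) (λ t → δ (proj₁ p +c scale m t) (s +c scale m w)) ≡ false
  misses p s≢p = xorSum-All-false
    (universal (λ t → δ-≢ (Incongruent⇒≢ {m} {s} {proj₁ p} s≢p w t ∘ sym)) (proj₂ p))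

Reduced-expand : ∀ m .{{_ : ℕ.NonZero m}} ps → Separated m ps → All (Reduced ∘ proj₂) ps →
                 Reduced (expand m ps)
Reduced-expand m []             _                  _                = tt
Reduced-expand m ((u , T) ∷ ps) (u-incong ∷ ps-sep) (T-red ∷ ps-red) =
  Reduced-++ (shift u (dilate m T)) (expand m ps)
    (Reduced-map (+c-cancelˡ u) (dilate m T) (Reduced-map (scale-injective m) T T-red))
    (Reduced-expand m ps ps-sep ps-red)
    (Allₚ.map⁺ (Allₚ.map⁺ (universal (λ t → coeff-expand-incongruent u ps t u-incong) T)))

length-expand : ∀ m ps → length (expand m ps) ≡ sum (map (length ∘ proj₂) ps)
length-expand m []             = refl
length-expand m ((u , T) ∷ ps) = trans (length-++ (shift u (dilate m T)))
  (cong₂ _+_ (trans (length-map (u +c_) (dilate m T)) (length-map (scale m) T))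
             (length-expand m ps))

length-⊗-dilate : ∀ m .{{_ : ℕ.NonZero m}} {P} ps K → P ≈ expand m ps → Separated m ps →
                  length (P ⊗ dilate m K) ≡ sum (map (λ p → length (proj₂ p ⊗ K)) ps)
length-⊗-dilate m {P} ps K P≈ps ps-sep = begin
  length (P ⊗ dilate m K)         ≡⟨ length-≈ (⊗-Reduced P (dilate m K)) ps'-red
                                       (≈-trans (⊗-cong P≈ps (≈-refl {dilate m K}))
                                                (expand-⊗-dilate m ps K)) ⟩
  length (expand m ps')           ≡⟨ length-expand m ps' ⟩
  sum (map (length ∘ proj₂) ps')  ≡⟨ cong sum (map-∘ {g = length ∘ proj₂} {f = map₂ (_⊗ K)} ps) ⟨
  sum (map (λ p → length (proj₂ p ⊗ K)) ps) ∎
  where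
  open ≡-Reasoning
  ps' = map (map₂ (_⊗ K)) ps
  ps'-red : Reduced (expand m ps')
  ps'-red = Reduced-expand m ps' (AllPairs.map⁺ ps-sep)
              (Allₚ.map⁺ (universal (λ p → ⊗-Reduced (proj₂ p) K) ps))

-- A block (T , S) stands for S · T(x^m, y^m).
gather : List (LPoly × LPoly) → List (Cell × LPoly)
gather []             = []
gather ((T , S) ∷ bs) = map (_, T) S ++ gather bs

sum-gather : ∀ (w : LPoly → ℕ) bs →
             sum (map (w ∘ proj₂) (gather bs)) ≡ sum (map (λ b → length (proj₂ b) * w (proj₁ b)) bs)
sum-gather w []                 = refl
sum-gather w ((T , [])    ∷ bs) = sum-gather w bs
sum-gather w ((T , s ∷ S) ∷ bs) =
  trans (cong (_+_ (w T)) (sum-gather w ((T , S) ∷ bs))) (sym (ℕₚ.+-assoc (w T) (length S * w T) _))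

record Decomposition (m : ℕ) (P : LPoly) : Set where
  field
    blocks    : List (LPoly × LPoly)
    expands   : P ≈ expand m (gather blocks)
    separated : Separated m (gather blocks)
open Decomposition

decomposition : ∀ m P bs → P ⊕ expand m (gather bs) ≡ [] → True (separated? m (gather bs)) →
                Decomposition m P
decomposition m P bs P⊕bs≡[] bs-sep = record
  { blocks    = bs
  ; expands   = ⊕≡[]⇒≈ P _ P⊕bs≡[]
  ; separated = toWitness bs-sep
  }

length-⊗-dilate-blocks : ∀ {m} .{{_ : ℕ.NonZero m}} {P} (D : Decomposition m P) K →
  length (P ⊗ dilate m K) ≡ sum (map (λ b → length (proj₂ b) * length (proj₁ b ⊗ K)) (blocks D))
length-⊗-dilate-blocks {m} D K =
  trans (length-⊗-dilate m (gather (blocks D)) K (expands D) (separated D))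
        (sum-gather (λ T → length (T ⊗ K)) (blocks D))

-- Fredkin's Replicator

1+x 1+y 1+xy x+y 1+x+y+xy : LPoly
1+x      = (+ 0 , + 0) ∷ (+ 1 , + 0) ∷ []
1+y      = (+ 0 , + 0) ∷ (+ 0 , + 1) ∷ []
1+xy     = (+ 0 , + 0) ∷ (+ 1 , + 1) ∷ []
x+y      = (+ 1 , + 0) ∷ (+ 0 , + 1) ∷ []
1+x+y+xy = (+ 0 , + 0) ∷ (+ 1 , + 0) ∷ (+ 0 , + 1) ∷ (+ 1 , + 1) ∷ []

F-mod-2 : Decomposition 2 (F ^ 1)
F-mod-2 = decomposition 2 (F ^ 1)
  ( (1+x      , (- + 1 , + 0) ∷ [])
  ∷ (1+y      , (+ 0 , - + 1) ∷ [])
  ∷ (1+x+y+xy , (- + 1 , - + 1) ∷ [])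
  ∷ []) refl _

F-mod-4 : Decomposition 4 (F ^ 1)
F-mod-4 = decomposition 4 (F ^ 1) ((one , F) ∷ []) refl _

F³-mod-4 : Decomposition 4 (F ^ 3)
F³-mod-4 = decomposition 4 (F ^ 3)
  ( (1+x  , (- + 3 , + 0) ∷ (- + 2 , - + 3) ∷ (- + 2 , + 3) ∷ (- + 1 , + 0) ∷ [])
  ∷ (1+y  , (- + 3 , - + 2) ∷ (+ 0 , - + 3) ∷ (+ 0 , - + 1) ∷ (+ 3 , - + 2) ∷ [])
  ∷ (1+xy , (- + 3 , - + 3) ∷ (- + 1 , - + 1) ∷ [])
  ∷ (x+y  , (- + 3 , - + 1) ∷ (- + 1 , - + 3) ∷ [])
  ∷ []) refl _

F³-mod-8 : Decomposition 8 (F ^ 3)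
F³-mod-8 = decomposition 8 (F ^ 3) ((one , F ^ 3) ∷ []) refl _

F⁷-mod-8 : Decomposition 8 (F ^ 7)
F⁷-mod-8 = decomposition 8 (F ^ 7)
  ( (1+x ,
      (- + 7 , - + 6) ∷ (- + 7 , + 0) ∷ (- + 7 , + 6) ∷ (- + 6 , - + 3) ∷
      (- + 6 , + 3) ∷ (- + 5 , + 0) ∷ (- + 4 , - + 7) ∷ (- + 4 , - + 5) ∷
      (- + 4 , + 5) ∷ (- + 4 , + 7) ∷ (- + 3 , + 0) ∷ (- + 2 , - + 3) ∷
      (- + 2 , + 3) ∷ (- + 1 , - + 6) ∷ (- + 1 , + 0) ∷ (- + 1 , + 6) ∷ [])
  ∷ (1+y ,
      (- + 7 , - + 4) ∷ (- + 6 , - + 7) ∷ (- + 6 , - + 1) ∷ (- + 5 , - + 4) ∷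
      (- + 3 , - + 6) ∷ (- + 3 , - + 2) ∷ (+ 0 , - + 7) ∷ (+ 0 , - + 5) ∷
      (+ 0 , - + 3) ∷ (+ 0 , - + 1) ∷ (+ 3 , - + 6) ∷ (+ 3 , - + 2) ∷
      (+ 5 , - + 4) ∷ (+ 6 , - + 7) ∷ (+ 6 , - + 1) ∷ (+ 7 , - + 4) ∷ [])
  ∷ (1+xy ,
      (- + 7 , - + 3) ∷ (- + 5 , - + 1) ∷ (- + 3 , - + 7) ∷ (- + 1 , - + 5) ∷ [])
  ∷ (x+y ,
      (- + 7 , - + 5) ∷ (- + 5 , - + 7) ∷ (- + 3 , - + 1) ∷ (- + 1 , - + 3) ∷ [])
  ∷ (1+x+y+xy ,
      (- + 7 , - + 7) ∷ (- + 7 , - + 1) ∷ (- + 5 , - + 5) ∷ (- + 5 , - + 3) ∷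
      (- + 3 , - + 5) ∷ (- + 3 , - + 3) ∷ (- + 1 , - + 7) ∷ (- + 1 , - + 1) ∷ [])
  ∷ []) refl _

a-dilated : ∀ j k s → a (j + 2 ℕ.^ k * s) ≡ length ((F ^ j) ⊗ dilate (2 ℕ.^ k) (F ^ s))
a-dilated j k s =
  length-≈ (^-Reduced F (j + 2 ℕ.^ k * s)) (⊗-Reduced (F ^ j) (dilate (2 ℕ.^ k) (F ^ s)))
  (≈-trans (^-+ F j _) (⊗-cong (≈-refl {F ^ j}) (^-2^k* F k s)))

a-blocks : ∀ j k s (D : Decomposition (2 ℕ.^ k) (F ^ j)) →
  a (j + 2 ℕ.^ k * s) ≡ sum (map (λ b → length (proj₂ b) * length (proj₁ b ⊗ (F ^ s))) (blocks D))
a-blocks j k s D = trans (a-dilated j k s) (length-⊗-dilate-blocks {{ℕₚ.m^n≢0 2 k}} D (F ^ s))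

length-one-⊗ : ∀ s → length (one ⊗ (F ^ s)) ≡ a s
length-one-⊗ s = length-≈ (⊗-Reduced one (F ^ s)) (^-Reduced F s) (⊗-identityˡ (F ^ s))

a[2t] : ∀ t → a (2 * t) ≡ a t
a[2t] t = trans
  (length-≈ (^-Reduced F (2 * t)) (Reduced-map (scale-injective 2) (F ^ t) (^-Reduced F t)) (^-2* F t))
  (length-map (scale 2) (F ^ t))

a[1+4s] : ∀ s → a (1 + 4 * s) ≡ 8 * a s
a[1+4s] s =
  trans (a-blocks 1 2 s F-mod-4) (trans (ℕₚ.+-identityʳ _) (cong (8 *_) (length-one-⊗ s)))

a[3+8s] : ∀ s → a (3 + 8 * s) ≡ 24 * a s
a[3+8s] s =
  trans (a-blocks 3 3 s F³-mod-8) (trans (ℕₚ.+-identityʳ _) (cong (24 *_) (length-one-⊗ s)))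

even-or-odd : ∀ n → (∃[ k ] n ≡ 2 * k) ⊎ (∃[ k ] n ≡ 1 + 2 * k)
even-or-odd ℕ.zero = inj₁ (0 , refl)
even-or-odd (ℕ.suc n) with even-or-odd n
... | inj₁ (k , refl) = inj₂ (k , refl)
... | inj₂ (k , refl) = inj₁ (1 + k , cong ℕ.suc (sym (ℕₚ.+-suc k (k + 0))))

a[4t+3] : ∀ t → a (4 * t + 3) ≡ 2 * a (2 * t + 1) + 8 * a t
a[4t+3] t with even-or-odd t
... | inj₁ (s , refl) = begin
  a (4 * (2 * s) + 3)                       ≡⟨ cong a (index₁ s) ⟩
  a (3 + 8 * s)                             ≡⟨ a[3+8s] s ⟩
  24 * a s                                  ≡⟨ regroup (a s) ⟩
  2 * (8 * a s) + 8 * a s                   ≡⟨ cong₂ (λ x y → 2 * x + 8 * y)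
                                                 (trans (cong a (index₂ s)) (a[1+4s] s)) (a[2t] s) ⟨
  2 * a (2 * (2 * s) + 1) + 8 * a (2 * s)   ∎
  where
  open ≡-Reasoning
  index₁ : ∀ s → 4 * (2 * s) + 3 ≡ 3 + 8 * s
  index₁ = ℕ-solve
  index₂ : ∀ s → 2 * (2 * s) + 1 ≡ 1 + 4 * s
  index₂ = ℕ-solve
  regroup : ∀ n → 24 * n ≡ 2 * (8 * n) + 8 * n
  regroup = ℕ-solve
... | inj₂ (s , refl) = begin
  a (4 * (1 + 2 * s) + 3)                          ≡⟨ cong a (index₁ s) ⟩
  a (7 + 8 * s)                                    ≡⟨ a-blocks 7 3 s F⁷-mod-8 ⟩
  16 * A + (16 * B + (4 * C + (4 * D + (8 * E + 0)))) ≡⟨ regroup A B C D E ⟩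
  2 * (4 * A + (4 * B + (2 * C + (2 * D + 0)))) + 8 * (1 * A + (1 * B + (1 * E + 0)))
    ≡⟨ cong₂ (λ x y → 2 * x + 8 * y)
         (trans (cong a (index₂ s)) (a-blocks 3 2 s F³-mod-4)) (a-blocks 1 1 s F-mod-2) ⟨
  2 * a (2 * (1 + 2 * s) + 1) + 8 * a (1 + 2 * s)  ∎
  where
  open ≡-Reasoning
  A B C D E : ℕ
  A = length (1+x ⊗ (F ^ s))
  B = length (1+y ⊗ (F ^ s))
  C = length (1+xy ⊗ (F ^ s))
  D = length (x+y ⊗ (F ^ s))
  E = length (1+x+y+xy ⊗ (F ^ s))
  index₁ : ∀ s → 4 * (1 + 2 * s) + 3 ≡ 7 + 8 * s
  index₁ = ℕ-solve
  index₂ : ∀ s → 2 * (1 + 2 * s) + 1 ≡ 3 + 4 * s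
  index₂ = ℕ-solve
  regroup : ∀ A B C D E → 16 * A + (16 * B + (4 * C + (4 * D + (8 * E + 0))))
          ≡ 2 * (4 * A + (4 * B + (2 * C + (2 * D + 0)))) + 8 * (1 * A + (1 * B + (1 * E + 0)))
  regroup = ℕ-solve

mainTheorem4 : (a 0 ≡ 1)
    × (∀ (t : ℕ) → 0 < t →
         (a (2 * t) ≡ a t)
         × (a (4 * t + 1) ≡ 8 * a t)
         × (a (4 * t + 3) ≡ 2 * a (2 * t + 1) + 8 * a t))
mainTheorem4 = refl , λ t _ → a[2t] t , trans (cong a (ℕₚ.+-comm (4 * t) 1)) (a[1+4s] t) , a[4t+3] t
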